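{- Let $q,q',n$ be integers with $q'\ge 2q-1>2$ and $n>1$. Let $S$ be an $\mathcal{OS}_q(n)$ with ring sequence $[s_0,\ldots,s_{m-1}]$, let $S'$ be the sequence over $\mathbb{Z}_{q'}$ with ring sequence $[s'_0,\ldots,s'_{m-1}]$, and let $S''$ be the periodic sequence over $\mathbb{Z}_{q'}$ whose ring sequence is the concatenation $[s'_0,\ldots,s'_{m-1},-s'_0,\ldots,-s'_{m-1}]$ of the ring sequences of $S'$ and $-S'$. Then $S''$ is an $\mathcal{SOS}_{q'}(n)$ with $w_{q'}(S'')=0$.
   Context: For $x\in\mathbb{Z}_q$, $x'$ denotes the residue class in $\mathbb{Z}_{q'}$ of the unique integer in $\{0,\ldots,q-1\}$ representing $x$. A periodic sequence of period $m$ is described by its ring sequence (one period). Write $\mathbf{s}_n(i)=(s_i,\ldots,s_{i+n-1})$; for an $n$-tuple $\mathbf{u}$, $\mathbf{u}^R$ is its reverse and $-\mathbf{u}$ its entrywise negative. An $n$-window sequence of period $m$ is one where $\mathbf{s}_n(i)=\mathbf{s}_n(j)$ implies $i\equiv j\pmod m$. An $\mathcal{OS}_q(n)$ is an $n$-window sequence over $\mathbb{Z}_q$ with $\mathbf{s}_n(i)\neq\mathbf{s}_n(j)^R$ for all $i,j$; an $\mathcal{SOS}_q(n)$ is an $\mathcal{OS}_q(n)$ with additionally $\mathbf{s}_n(i)\neq-\mathbf{s}_n(j)^R$ for all $i,j$. The weight $w(S)$ of a sequence over $\mathbb{Z}_{q'}$ is the sum of the terms of its ring sequence, each treated as an integer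 in $[0,q'-1]$, and $w_{q'}(S)=w(S)\bmod q'$. -}

module Defs where

open import Data.Nat using (ℕ; zero; suc; _+_; _∸_; _*_; NonZero; _%_)
open import Data.Nat.DivMod using (_mod_)
open import Data.Fin using (Fin; toℕ; splitAt)
open import Data.Sum using ([_,_])
open import Data.Vec using (Vec; tabulate; reverse; map)
open import Data.List using (allFin) renaming (map to lmap)
open import Data.Nat.ListAction using () renaming (sum to lsum)
open import Data.Product using (_×_)
open import Relation.Binary.PropositionalEquality using (_≡_; _≢_)

-- Z_q is represented by Fin q; a periodic sequence of period m over Z_q is
-- given by its ring sequence  r : Fin m → Fin q  (one period s_0 … s_{m-1}).

term : ∀ {q m} .{{_ : NonZero m}} → (Fin m → Fin q) → ℕ → Fin q
term {m = m} r i = r (i mod m)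

window : ∀ {q m} .{{_ : NonZero m}} → (n : ℕ) → (Fin m → Fin q) → ℕ → Vec (Fin q) n
window n r i = tabulate (λ k → term r (i + toℕ k))

negZ : ∀ {q} .{{_ : NonZero q}} → Fin q → Fin q
negZ {q} x = (q ∸ toℕ x) mod q

lift : ∀ {q} q' .{{_ : NonZero q'}} → Fin q → Fin q'
lift q' x = toℕ x mod q'

IsWindowSeq : ∀ {q m} .{{_ : NonZero m}} → ℕ → (Fin m → Fin q) → Set
IsWindowSeq {m = m} n r = ∀ i j → window n r i ≡ window n r j → i % m ≡ j % m

IsOS : ∀ {q m} .{{_ : NonZero m}} → ℕ → (Fin m → Fin q) → Set
IsOS n r = IsWindowSeq n r × (∀ i j → window n r i ≢ reverse (window n r j))

IsSOS : ∀ {q m} .{{_ : NonZero q}} .{{_ : NonZero m}} → ℕ → (Fin m → Fin q) → Set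
IsSOS n r = IsOS n r × (∀ i j → window n r i ≢ map negZ (reverse (window n r j)))

weight : ∀ {q m} → (Fin m → Fin q) → ℕ
weight {m = m} r = lsum (lmap (λ i → toℕ (r i)) (allFin m))

concatNeg : ∀ {q m} .{{_ : NonZero q}} → (Fin m → Fin q) → Fin (m + m) → Fin q
concatNeg {m = m} r i = [ r , (λ j → negZ (r j)) ] (splitAt m i)

instance
  nonZero-double : ∀ {m} .{{_ : NonZero m}} → NonZero (m + m)
  nonZero-double {suc m} = _

{-# OPTIONS --safe #-}
module Submission where

-- The i-th term of S'' is ±s'_i, with sign + exactly when i mod 2m < m. Since q' ≥ 2q − 1,
-- x' = −y' in Z_q' forces x = y = 0 (as x + y < q'), so ±x' = ±y' implies x = y, and even
-- x = y = 0 when the signs differ. Hence equality of a window of S'' with a window, a reversed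
-- window or a negated reversed window of S'' gives equality of the corresponding windows of S
-- (the negation disappears). For equal windows at i and j this yields i ≡ j (mod m); if
-- i ≢ j (mod 2m), the signs differ at every position, so the window of S at i is all zeros and
-- equals its own reverse, which an OS forbids. The weight of S'' is a sum of pairs s'_i + (−s'_i),
-- each divisible by q'.

open import Defs
open import Data.Nat using (ℕ; zero; suc; _+_; _*_; _∸_; _≤_; _<_; _%_; NonZero; z<s; >-nonZero⁻¹)
open import Data.Nat.Properties
open import Data.Nat.DivMod using (_mod_; %-distribˡ-+; [m+kn]%n≡m%n; [m+n]%n≡m%n; m<n⇒m%n≡m; n%n≡0; m∣n⇒o%n%m≡o%m)
open import Data.Nat.Divisibility using (_∣_; _∣0; ∣-refl; ∣m∣n⇒∣m+n; n∣m⇒m%n≡0)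
open import Data.Nat.ListAction using () renaming (sum to lsum)
open import Algebra.Properties.CommutativeSemigroup +-commutativeSemigroup using (interchange)
open import Data.Fin using (Fin; toℕ; splitAt; join; _↑ˡ_; _↑ʳ_) renaming (zero to fzero; suc to fsuc)
open import Data.Fin.Properties using (toℕ-injective; toℕ<n; toℕ-fromℕ<; toℕ-↑ˡ; toℕ-↑ʳ; splitAt-↑ˡ; splitAt-↑ʳ; splitAt⁻¹-↑ˡ; splitAt⁻¹-↑ʳ; join-splitAt)
open import Data.Bool using (Bool; true; false; not)
open import Data.Bool.Properties using (¬-not) renaming (_≟_ to _≟ᵇ_)
open import Data.Empty using (⊥-elim)
open import Data.Sum using (_⊎_; inj₁; inj₂; [_,_]′)
open import Data.Product using (_×_; _,_; proj₁; proj₂)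
open import Data.Vec using (Vec; []; _∷_; map; reverse; tabulate; lookup; replicate)
open import Data.Vec.Properties using (map-reverse; map-const; map-∘; lookup∘tabulate; tabulate-cong; tabulate-∘; ∷-injective)
open import Data.List using () renaming (tabulate to ltabulate)
open import Data.List.Properties using (map-tabulate) renaming (tabulate-cong to ltabulate-cong)
open import Relation.Binary.PropositionalEquality
open import Relation.Nullary using (yes; no)
open import Function using (_∘_; const; id)

map-≡-transfer : ∀ {a b c} {A : Set a} {B : Set b} {C : Set c} {f g : A → C} (h : A → B) →
  (∀ x y → f x ≡ g y → h x ≡ h y) → ∀ {n} (xs ys : Vec A n) → map f xs ≡ map g ys → map h xs ≡ map h ys
map-≡-transfer h transfer [] [] _ = refl
map-≡-transfer h transfer (x ∷ xs) (y ∷ ys) e with ∷-injective e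
... | ex , exs = cong₂ _∷_ (transfer x y ex) (map-≡-transfer h transfer xs ys exs)

reverse-tabulate-constant : ∀ {a} {A : Set a} {n} (f : Fin n → A) → (∀ k l → f k ≡ f l) →
  reverse (tabulate f) ≡ tabulate f
reverse-tabulate-constant {n = zero} f _ = refl
reverse-tabulate-constant {n = suc n} f f-constant = begin
  reverse (tabulate f)         ≡⟨ cong reverse tabulate≡map ⟩
  reverse (map c (tabulate f)) ≡⟨ map-reverse c (tabulate f) ⟨
  map c (reverse (tabulate f)) ≡⟨ map-const (reverse (tabulate f)) (f fzero) ⟩
  replicate (suc n) (f fzero)  ≡⟨ map-const (tabulate f) (f fzero) ⟨
  map c (tabulate f)           ≡⟨ tabulate≡map ⟨
  tabulate f                   ∎
  where
  open ≡-Reasoning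
  c = const (f fzero)
  tabulate≡map : tabulate f ≡ map c (tabulate f)
  tabulate≡map = trans (tabulate-cong (λ k → f-constant k fzero)) (tabulate-∘ c f)

tabulate-injective : ∀ {a} {A : Set a} {n} {f g : Fin n → A} → tabulate f ≡ tabulate g → ∀ k → f k ≡ g k
tabulate-injective {f = f} {g} e k = trans (sym (lookup∘tabulate f k)) (trans (cong (λ v → lookup v k) e) (lookup∘tabulate g k))

sum-tabulate-↑ : ∀ m {n} (f : Fin (m + n) → ℕ) →
  lsum (ltabulate f) ≡ lsum (ltabulate (f ∘ (_↑ˡ n))) + lsum (ltabulate (f ∘ (m ↑ʳ_)))
sum-tabulate-↑ zero f = refl
sum-tabulate-↑ (suc m) f = trans (cong (f fzero +_) (sum-tabulate-↑ m (f ∘ fsuc))) (sym (+-assoc (f fzero) _ _))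

∣-sum-tabulate-+ : ∀ {d n} (f g : Fin n → ℕ) → (∀ i → d ∣ f i + g i) →
  d ∣ lsum (ltabulate f) + lsum (ltabulate g)
∣-sum-tabulate-+ {d} {zero} f g _ = d ∣0
∣-sum-tabulate-+ {d} {suc n} f g d∣f+g =
  subst (d ∣_) (interchange (f fzero) (g fzero) (lsum (ltabulate (f ∘ fsuc))) (lsum (ltabulate (g ∘ fsuc))))
    (∣m∣n⇒∣m+n (d∣f+g fzero) (∣-sum-tabulate-+ (f ∘ fsuc) (g ∘ fsuc) (d∣f+g ∘ fsuc)))

%-+-congʳ : ∀ a b k {N} .{{_ : NonZero N}} → a % N ≡ b % N → (a + k) % N ≡ (b + k) % N
%-+-congʳ a b k {N} a≡b = begin
  (a + k) % N           ≡⟨ %-distribˡ-+ a k N ⟩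
  (a % N + k % N) % N   ≡⟨ cong (λ x → (x + k % N) % N) a≡b ⟩
  (b % N + k % N) % N   ≡⟨ %-distribˡ-+ b k N ⟨
  (b + k) % N           ∎
  where open ≡-Reasoning

-- (x + k) + k(N − 1) = x + kN ≡ x (mod N).
%-+-cancelʳ : ∀ a b k {N} .{{_ : NonZero N}} → (a + k) % N ≡ (b + k) % N → a % N ≡ b % N
%-+-cancelʳ a b k {N@(suc N₀)} a+k≡b+k = begin
  a % N                         ≡⟨ [m+kn]%n≡m%n a k N ⟨
  (a + k * N) % N               ≡⟨ cong (_% N) (regroup a) ⟩
  ((a + k) + k * N₀) % N        ≡⟨ %-+-congʳ (a + k) (b + k) (k * N₀) a+k≡b+k ⟩
  ((b + k) + k * N₀) % N        ≡⟨ cong (_% N) (regroup b) ⟨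
  (b + k * N) % N               ≡⟨ [m+kn]%n≡m%n b k N ⟩
  b % N                         ∎
  where
  open ≡-Reasoning
  regroup : ∀ x → x + k * N ≡ (x + k) + k * N₀
  regroup x = trans (cong (x +_) (*-suc k N₀)) (sym (+-assoc x k _))

toℕ-mod : ∀ i {n} .{{_ : NonZero n}} → toℕ (i mod n) ≡ i % n
toℕ-mod i = toℕ-fromℕ< _

[n∸m]%n≡n∸m : ∀ {m n} .{{_ : NonZero n}} → 0 < m → m ≤ n → (n ∸ m) % n ≡ n ∸ m
[n∸m]%n≡n∸m {n = n} 0<m m≤n = m<n⇒m%n≡m (∸-monoʳ-< {n} 0<m m≤n)

module _ {n : ℕ} .{{_ : NonZero n}} where

  toℕ-negZ : (z : Fin n) → toℕ (negZ z) ≡ (n ∸ toℕ z) % n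
  toℕ-negZ z = toℕ-fromℕ< _

  toℕ-negZ-cases : (z : Fin n) → (toℕ z ≡ 0 × toℕ (negZ z) ≡ 0) ⊎ toℕ z + toℕ (negZ z) ≡ n
  toℕ-negZ-cases z rewrite toℕ-negZ z = cases (toℕ z) (toℕ<n z)
    where
    cases : ∀ a → a < n → (a ≡ 0 × (n ∸ a) % n ≡ 0) ⊎ a + (n ∸ a) % n ≡ n
    cases zero    _   = inj₁ (refl , n%n≡0 n)
    cases (suc a) a<n = inj₂ (trans (cong (suc a +_) ([n∸m]%n≡n∸m z<s (<⇒≤ a<n))) (m+[n∸m]≡n (<⇒≤ a<n)))

  negZ-involutive : (z : Fin n) → negZ (negZ z) ≡ z
  negZ-involutive z = toℕ-injective (begin
    toℕ (negZ (negZ z))       ≡⟨ toℕ-negZ (negZ z) ⟩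
    (n ∸ toℕ (negZ z)) % n    ≡⟨ cong (λ w → (n ∸ w) % n) (toℕ-negZ z) ⟩
    (n ∸ (n ∸ toℕ z) % n) % n ≡⟨ involutive (toℕ z) (toℕ<n z) ⟩
    toℕ z                     ∎)
    where
    open ≡-Reasoning
    involutive : ∀ a → a < n → (n ∸ (n ∸ a) % n) % n ≡ a
    involutive zero    _   = trans (cong (λ w → (n ∸ w) % n) (n%n≡0 n)) (n%n≡0 n)
    involutive (suc a) a<n = begin
      (n ∸ (n ∸ suc a) % n) % n ≡⟨ cong (λ w → (n ∸ w) % n) ([n∸m]%n≡n∸m z<s (<⇒≤ a<n)) ⟩
      (n ∸ (n ∸ suc a)) % n     ≡⟨ cong (_% n) (m∸[m∸n]≡n (<⇒≤ a<n)) ⟩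
      suc a % n                 ≡⟨ m<n⇒m%n≡m a<n ⟩
      suc a                     ∎

  negZ-injective : {x y : Fin n} → negZ x ≡ negZ y → x ≡ y
  negZ-injective {x} {y} e = trans (sym (negZ-involutive x)) (trans (cong negZ e) (negZ-involutive y))

  ∣toℕ+toℕ-negZ : (z : Fin n) → n ∣ toℕ z + toℕ (negZ z)
  ∣toℕ+toℕ-negZ z with toℕ-negZ-cases z
  ... | inj₁ (z≡0 , -z≡0) = subst (n ∣_) (sym (cong₂ _+_ z≡0 -z≡0)) (n ∣0)
  ... | inj₂ z+-z≡n       = subst (n ∣_) (sym z+-z≡n) ∣-refl

  ≡negZ⇒toℕ≡0 : {x y : Fin n} → toℕ x + toℕ y < n → x ≡ negZ y → toℕ x ≡ 0 × toℕ y ≡ 0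
  ≡negZ⇒toℕ≡0 {x} {y} x+y<n refl with toℕ-negZ-cases y
  ... | inj₁ (y≡0 , -y≡0) = -y≡0 , y≡0
  ... | inj₂ y+-y≡n       = ⊥-elim (<-irrefl (trans (+-comm _ (toℕ y)) y+-y≡n) x+y<n)

  signed : Bool → Fin n → Fin n
  signed true  = id
  signed false = negZ

  signed-injective : ∀ b {x y : Fin n} → signed b x ≡ signed b y → x ≡ y
  signed-injective true  = id
  signed-injective false = negZ-injective

  negZ-signed : ∀ b (z : Fin n) → negZ (signed b z) ≡ signed (not b) z
  negZ-signed true  z = refl
  negZ-signed false z = negZ-involutive z

  signed-opposite : ∀ b {x y : Fin n} → signed b x ≡ signed (not b) y → x ≡ negZ y
  signed-opposite true  e = e
  signed-opposite false e = trans (sym (negZ-involutive _)) (cong negZ e)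

weight-concatNeg : ∀ {q m} .{{_ : NonZero q}} (r : Fin m → Fin q) → weight (concatNeg r) % q ≡ 0
weight-concatNeg {q} {m} r =
  n∣m⇒m%n≡0 _ q (subst (q ∣_) (sym weight≡) (∣-sum-tabulate-+ _ _ (∣toℕ+toℕ-negZ ∘ r)))
  where
  open ≡-Reasoning
  weight≡ : weight (concatNeg r) ≡ lsum (ltabulate (toℕ ∘ r)) + lsum (ltabulate (toℕ ∘ negZ ∘ r))
  weight≡ = begin
    weight (concatNeg r)                       ≡⟨ cong lsum (map-tabulate id (toℕ ∘ concatNeg r)) ⟩
    lsum (ltabulate (toℕ ∘ concatNeg r))       ≡⟨ sum-tabulate-↑ m (toℕ ∘ concatNeg r) ⟩
    lsum (ltabulate (λ i → toℕ (concatNeg r (i ↑ˡ m)))) + lsum (ltabulate (λ i → toℕ (concatNeg r (m ↑ʳ i))))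
      ≡⟨ cong₂ _+_ (cong lsum (ltabulate-cong (λ i → cong (toℕ ∘ [ r , negZ ∘ r ]′) (splitAt-↑ˡ m i m))))
                   (cong lsum (ltabulate-cong (λ i → cong (toℕ ∘ [ r , negZ ∘ r ]′) (splitAt-↑ʳ m m i)))) ⟩
    lsum (ltabulate (toℕ ∘ r)) + lsum (ltabulate (toℕ ∘ negZ ∘ r)) ∎

module Lift (q q' : ℕ) .{{_ : NonZero q}} .{{_ : NonZero q'}} (2q∸1≤q' : 2 * q ∸ 1 ≤ q') where

  q≤q' : q ≤ q'
  q≤q' = ≤-trans (m+n≤o⇒m≤o∸n q (≤-trans (+-monoʳ-≤ q (>-nonZero⁻¹ q)) (≤-reflexive q+q≡2q))) 2q∸1≤q'
    where
    q+q≡2q : q + q ≡ 2 * q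
    q+q≡2q = cong (q +_) (sym (+-identityʳ q))

  toℕ+toℕ<q' : (x y : Fin q) → toℕ x + toℕ y < q'
  toℕ+toℕ<q' x y = ≤-trans (m+n≤o⇒m≤o∸n (suc (toℕ x + toℕ y)) bound) 2q∸1≤q'
    where
    bound : suc (toℕ x + toℕ y) + 1 ≤ 2 * q
    bound = begin
      suc (toℕ x + toℕ y) + 1 ≡⟨ +-comm (suc (toℕ x + toℕ y)) 1 ⟩
      suc (suc (toℕ x + toℕ y)) ≡⟨ cong suc (+-suc (toℕ x) (toℕ y)) ⟨
      suc (toℕ x) + suc (toℕ y) ≤⟨ +-mono-≤ (toℕ<n x) (toℕ<n y) ⟩
      q + q                     ≡⟨ cong (q +_) (+-identityʳ q) ⟨
      2 * q                     ∎
      where open ≤-Reasoning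

  toℕ-lift : (x : Fin q) → toℕ (lift q' x) ≡ toℕ x
  toℕ-lift x = trans (toℕ-fromℕ< _) (m<n⇒m%n≡m (≤-trans (toℕ<n x) q≤q'))

  lift-injective : {x y : Fin q} → lift q' x ≡ lift q' y → x ≡ y
  lift-injective {x} {y} e = toℕ-injective (trans (sym (toℕ-lift x)) (trans (cong toℕ e) (toℕ-lift y)))

  lift≡negZ-lift⇒toℕ≡0 : {x y : Fin q} → lift q' x ≡ negZ (lift q' y) → toℕ x ≡ 0 × toℕ y ≡ 0
  lift≡negZ-lift⇒toℕ≡0 {x} {y} e =
    let x'≡0 , y'≡0 = ≡negZ⇒toℕ≡0 lifts<q' e in trans (sym (toℕ-lift x)) x'≡0 , trans (sym (toℕ-lift y)) y'≡0
    where
    lifts<q' : toℕ (lift q' x) + toℕ (lift q' y) < q'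
    lifts<q' = subst (_< q') (sym (cong₂ _+_ (toℕ-lift x) (toℕ-lift y))) (toℕ+toℕ<q' x y)

  signed-lift-≢⇒toℕ≡0 : ∀ {a c} {x y : Fin q} → a ≢ c →
    signed a (lift q' x) ≡ signed c (lift q' y) → toℕ x ≡ 0 × toℕ y ≡ 0
  signed-lift-≢⇒toℕ≡0 {a} a≢c e rewrite ¬-not (a≢c ∘ sym) = lift≡negZ-lift⇒toℕ≡0 (signed-opposite a e)

  signed-lift-injective : ∀ a c {x y : Fin q} → signed a (lift q' x) ≡ signed c (lift q' y) → x ≡ y
  signed-lift-injective a c e with a ≟ᵇ c
  ... | yes refl = lift-injective (signed-injective a e)
  ... | no a≢c   = let x≡0 , y≡0 = signed-lift-≢⇒toℕ≡0 a≢c e in toℕ-injective (trans x≡0 (sym y≡0))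

module Halves {m : ℕ} .{{_ : NonZero m}} where

  half : Bool → Fin m → Fin m ⊎ Fin m
  half true  = inj₁
  half false = inj₂

  sign : ℕ → Bool
  sign i = [ const true , const false ]′ (splitAt m (i mod (m + m)))

  toℕ-mod-double : ∀ i → toℕ (i mod (m + m)) % m ≡ toℕ (i mod m)
  toℕ-mod-double i = begin
    toℕ (i mod (m + m)) % m ≡⟨ cong (_% m) (toℕ-mod i) ⟩
    i % (m + m) % m         ≡⟨ m∣n⇒o%n%m≡o%m m (m + m) i (∣m∣n⇒∣m+n ∣-refl ∣-refl) ⟩
    i % m                   ≡⟨ toℕ-mod i ⟨
    toℕ (i mod m)           ∎
    where open ≡-Reasoning

  splitAt-mod : ∀ i → splitAt m (i mod (m + m)) ≡ half (sign i) (i mod m)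
  splitAt-mod i with splitAt m (i mod (m + m)) in eq
  ... | inj₁ k = cong inj₁ (toℕ-injective (begin
    toℕ k                   ≡⟨ m<n⇒m%n≡m (toℕ<n k) ⟨
    toℕ k % m               ≡⟨ cong (_% m) (toℕ-↑ˡ k m) ⟨
    toℕ (k ↑ˡ m) % m        ≡⟨ cong (λ j → toℕ j % m) (splitAt⁻¹-↑ˡ eq) ⟩
    toℕ (i mod (m + m)) % m ≡⟨ toℕ-mod-double i ⟩
    toℕ (i mod m)           ∎))
    where open ≡-Reasoning
  ... | inj₂ k = cong inj₂ (toℕ-injective (begin
    toℕ k                   ≡⟨ m<n⇒m%n≡m (toℕ<n k) ⟨
    toℕ k % m               ≡⟨ [m+n]%n≡m%n (toℕ k) m ⟨
    (toℕ k + m) % m         ≡⟨ cong (_% m) (trans (+-comm (toℕ k) m) (sym (toℕ-↑ʳ m k))) ⟩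
    toℕ (m ↑ʳ k) % m        ≡⟨ cong (λ j → toℕ j % m) (splitAt⁻¹-↑ʳ eq) ⟩
    toℕ (i mod (m + m)) % m ≡⟨ toℕ-mod-double i ⟩
    toℕ (i mod m)           ∎))
    where open ≡-Reasoning

  term-concatNeg : ∀ {q} .{{_ : NonZero q}} (r : Fin m → Fin q) i →
    term (concatNeg r) i ≡ signed (sign i) (term r i)
  term-concatNeg r i = trans (cong [ r , negZ ∘ r ]′ (splitAt-mod i)) (pick (sign i))
    where
    pick : ∀ b → [ r , negZ ∘ r ]′ (half b (i mod m)) ≡ signed b (r (i mod m))
    pick true  = refl
    pick false = refl

  sign-mod-injective : ∀ i j → sign i ≡ sign j → i % m ≡ j % m → i % (m + m) ≡ j % (m + m)
  sign-mod-injective i j si≡sj i≡j = begin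
    i % (m + m)                              ≡⟨ toℕ-mod i ⟨
    toℕ (i mod (m + m))                      ≡⟨ cong toℕ (join-splitAt m m (i mod (m + m))) ⟨
    toℕ (join m m (splitAt m (i mod (m + m)))) ≡⟨ cong (toℕ ∘ join m m) halves≡ ⟩
    toℕ (join m m (splitAt m (j mod (m + m)))) ≡⟨ cong toℕ (join-splitAt m m (j mod (m + m))) ⟩
    toℕ (j mod (m + m))                      ≡⟨ toℕ-mod j ⟩
    j % (m + m)                              ∎
    where
    open ≡-Reasoning
    halves≡ : splitAt m (i mod (m + m)) ≡ splitAt m (j mod (m + m))
    halves≡ = begin
      splitAt m (i mod (m + m)) ≡⟨ splitAt-mod i ⟩
      half (sign i) (i mod m)   ≡⟨ cong₂ half si≡sj (toℕ-injective (trans (toℕ-mod i) (trans i≡j (sym (toℕ-mod j))))) ⟩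
      half (sign j) (j mod m)   ≡⟨ splitAt-mod j ⟨
      splitAt m (j mod (m + m)) ∎

  sign-+-≢ : ∀ i j → i % m ≡ j % m → i % (m + m) ≢ j % (m + m) → ∀ k → sign (i + k) ≢ sign (j + k)
  sign-+-≢ i j i≡j i≢j k s≡s =
    i≢j (%-+-cancelʳ i j k {m + m} (sign-mod-injective (i + k) (j + k) s≡s (%-+-congʳ i j k {m} i≡j)))

module Doubling (q q' m : ℕ) .{{_ : NonZero q}} .{{_ : NonZero q'}} .{{_ : NonZero m}}
                (2q∸1≤q' : 2 * q ∸ 1 ≤ q') (s : Fin m → Fin q) where

  open Lift q q' 2q∸1≤q'
  open Halves {m}

  S'' : Fin (m + m) → Fin q'
  S'' = concatNeg (λ i → lift q' (s i))

  signedLift : Bool × Fin q → Fin q'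
  signedLift (b , x) = signed b (lift q' x)

  signedWindow : ∀ n → ℕ → Vec (Bool × Fin q) n
  signedWindow n i = tabulate (λ k → sign (i + toℕ k) , term s (i + toℕ k))

  window-S'' : ∀ n i → window n S'' i ≡ map signedLift (signedWindow n i)
  window-S'' n i = trans (tabulate-cong (λ k → term-concatNeg _ (i + toℕ k))) (tabulate-∘ signedLift _)

  window-s : ∀ n i → window n s i ≡ map proj₂ (signedWindow n i)
  window-s n i = tabulate-∘ proj₂ _

  term-S''-injective : ∀ {i j} → term S'' i ≡ term S'' j → term s i ≡ term s j
  term-S''-injective {i} {j} e =
    signed-lift-injective (sign i) (sign j) (trans (sym (term-concatNeg _ i)) (trans e (term-concatNeg _ j)))

  window-S''-injective : ∀ n i j → window n S'' i ≡ window n S'' j → window n s i ≡ window n s j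
  window-S''-injective n i j e = tabulate-cong (term-S''-injective ∘ tabulate-injective e)

  S''-isWindowSeq : ∀ n → IsOS n s → IsWindowSeq n S''
  S''-isWindowSeq n (s-isWindowSeq , s-notReverse) i j e with i % (m + m) ≟ j % (m + m)
  ... | yes i≡j = i≡j
  ... | no i≢j = ⊥-elim (s-notReverse i i (sym (reverse-tabulate-constant _ entries-equal)))
    where
    i≡j[m] : i % m ≡ j % m
    i≡j[m] = s-isWindowSeq i j (window-S''-injective n i j e)
    entry-zero : ∀ k → toℕ (term s (i + toℕ k)) ≡ 0
    entry-zero k = proj₁ (signed-lift-≢⇒toℕ≡0 (sign-+-≢ i j i≡j[m] i≢j (toℕ k))
      (trans (sym (term-concatNeg _ (i + toℕ k))) (trans (tabulate-injective e k) (term-concatNeg _ (j + toℕ k)))))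
    entries-equal : ∀ k l → term s (i + toℕ k) ≡ term s (i + toℕ l)
    entries-equal k l = toℕ-injective (trans (entry-zero k) (sym (entry-zero l)))

  reverse-transfer : ∀ n i j {g : Bool × Fin q → Fin q'} → (∀ p p' → signedLift p ≡ g p' → proj₂ p ≡ proj₂ p') →
    map signedLift (signedWindow n i) ≡ map g (reverse (signedWindow n j)) → window n s i ≡ reverse (window n s j)
  reverse-transfer n i j transfer e = begin
    window n s i                           ≡⟨ window-s n i ⟩
    map proj₂ (signedWindow n i)           ≡⟨ map-≡-transfer proj₂ transfer _ _ e ⟩
    map proj₂ (reverse (signedWindow n j)) ≡⟨ map-reverse proj₂ (signedWindow n j) ⟩
    reverse (map proj₂ (signedWindow n j)) ≡⟨ cong reverse (window-s n j) ⟨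
    reverse (window n s j)                 ∎
    where open ≡-Reasoning

  S''-notReverse : ∀ n → IsOS n s → ∀ i j → window n S'' i ≢ reverse (window n S'' j)
  S''-notReverse n (_ , s-notReverse) i j e =
    s-notReverse i j (reverse-transfer n i j (λ (a , _) (c , _) → signed-lift-injective a c) (begin
      map signedLift (signedWindow n i)           ≡⟨ window-S'' n i ⟨
      window n S'' i                              ≡⟨ e ⟩
      reverse (window n S'' j)                    ≡⟨ cong reverse (window-S'' n j) ⟩
      reverse (map signedLift (signedWindow n j)) ≡⟨ map-reverse signedLift (signedWindow n j) ⟨
      map signedLift (reverse (signedWindow n j)) ∎))
    where open ≡-Reasoning

  S''-notNegReverse : ∀ n → IsOS n s → ∀ i j → window n S'' i ≢ map negZ (reverse (window n S'' j))
  S''-notNegReverse n (_ , s-notReverse) i j e =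
    s-notReverse i j (reverse-transfer n i j transfer (begin
      map signedLift (signedWindow n i)                      ≡⟨ window-S'' n i ⟨
      window n S'' i                                         ≡⟨ e ⟩
      map negZ (reverse (window n S'' j))                    ≡⟨ cong (map negZ ∘ reverse) (window-S'' n j) ⟩
      map negZ (reverse (map signedLift (signedWindow n j))) ≡⟨ cong (map negZ) (map-reverse signedLift (signedWindow n j)) ⟨
      map negZ (map signedLift (reverse (signedWindow n j))) ≡⟨ map-∘ negZ signedLift (reverse (signedWindow n j)) ⟨
      map (negZ ∘ signedLift) (reverse (signedWindow n j))   ∎))
    where
    open ≡-Reasoning
    transfer : ∀ p p' → signedLift p ≡ negZ (signedLift p') → proj₂ p ≡ proj₂ p'
    transfer (a , _) (c , y) e = signed-lift-injective a (not c) (trans e (negZ-signed c (lift q' y)))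

theorem3p8 : (q q' n m : ℕ) .{{_ : NonZero q}} .{{_ : NonZero q'}} .{{_ : NonZero m}} →
    2 * q ∸ 1 ≤ q' → 2 < 2 * q ∸ 1 → 1 < n →
    (s : Fin m → Fin q) → IsOS n s →
    IsSOS n (concatNeg (λ i → lift q' (s i))) × weight (concatNeg (λ i → lift q' (s i))) % q' ≡ 0
theorem3p8 q q' n m 2q∸1≤q' _ _ s s-isOS =
  ((S''-isWindowSeq n s-isOS , S''-notReverse n s-isOS) , S''-notNegReverse n s-isOS) , weight-concatNeg (λ i → lift q' (s i))
  where open Doubling q q' m 2q∸1≤q' s
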